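{- Let $k\geq 3$ and $n\ge1$ be integers and let $P$ be any $k$-way cut of $\Delta_{k,n}$. If $(i_1,i_2,i_3)$ is a uniformly random triple of distinct elements of $[k]$, then $\Pr[P_{(i_1,i_2,i_3)} \text{ is a non-opposite cut of } \Delta_{3,n}] \geq 1 - \frac{3(D(P)-2)}{k-2}$.
   Context: For integers $k\ge 2$, $n \geq 1$: $\Delta_k=\{x\in[0,1]^k : \sum_i x_i = 1\}$, $e^i$ is the $i$-th standard basis vector, $\mathrm{supp}(x)=\{i : x_i\neq 0\}$, and $\Delta_{k,n}$ is the set of points of $\Delta_k$ all of whose coordinates are multiples of $1/n$. A $k$-way cut of $\Delta_{k,n}$ is a map $P:\Delta_{k,n}\to[k]$ with $P(e^i)=i$ for all $i$. A non-opposite cut of $\Delta_{3,n}$ is a map $Q:\Delta_{3,n}\to[4]$ with $Q(e^i)=i$ for $i\in[3]$ and $Q(x)\in\mathrm{supp}(x)\cup\{4\}$ for all $x$. For a $k$-way cut $P$ and distinct $i_1,i_2,i_3\in[k]$, define $P_{(i_1,i_2,i_3)}:\Delta_{3,n}\to[4]$ by $P_{(i_1,i_2,i_3)}(x) = j$ if $P(x_1e^{i_1}+x_2e^{i_2}+x_3e^{i_3}) = i_j$ for some $j\in[3]$, and $=4$ otherwise. For $\{i,j\}\subseteq[k]$ with $i\ne j$, $D_{i,j}(P)=\{P(x) : x\in\Delta_{k,n},\ \mathrm{supp}(x)\subseteq\{i,j\}\}$, and $D(P)$ is the average of $|D_{i,j}(P)|$ over all $\binom{k}{2}$ two-element subsets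 $\{i,j\}\subseteq[k]$. -}

module Defs where

open import Data.Nat as ℕ using (ℕ; zero; suc; _+_; _∸_; _<_; _≤_; z≤n; s≤s)
import Data.Nat.Properties as ℕP
open import Data.Fin as Fin using (Fin; toℕ; inject₁; fromℕ)
import Data.Fin.Properties as FinP
open import Data.Vec as Vec using (Vec; []; _∷_; lookup; sum; replicate; zipWith; _[_]≔_)
open import Data.List as List using (List; []; _∷_; [_]; concatMap; upTo; allFin; filter; length; map; cartesianProduct)
open import Data.List.Membership.Propositional using (_∈_; lose; find)
open import Data.List.Membership.Propositional.Properties
  using (∈-concatMap⁺; ∈-concatMap⁻; ∈-map⁺; ∈-map⁻; ∈-upTo⁺; ∈-upTo⁻)
open import Data.List.Relation.Unary.All as All using (All)
open import Data.List.Relation.Unary.Any as Any using (Any; here; there)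
open import Data.Nat.ListAction using () renaming (sum to sumℕ)
open import Data.Product using (Σ; ∃; _×_; _,_; proj₁; proj₂)
open import Data.Sum using (_⊎_; inj₁; inj₂)
open import Data.Empty using (⊥-elim)
open import Function using (_∘_)
open import Relation.Nullary using (Dec; yes; no; ¬_)
open import Relation.Nullary.Decidable using (¬?; _×-dec_; _⊎-dec_; _→-dec_; map′)
open import Relation.Binary.PropositionalEquality using (_≡_; refl; sym; trans; cong; subst)
open import Data.Integer using () renaming (+_ to ℤ+_)
open import Data.Rational as ℚ using (ℚ; 0ℚ; _/_)

-- Points of Δ_{k,n}.
-- A point x ∈ Δ_{k,n} has coordinates x_i = a_i / n with a_i ∈ ℕ and
-- Σ a_i = n.  We represent x by the vector a = n·x ∈ ℕ^k.  Note
-- supp(x) = {i : a_i ≠ 0}.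

InΔ : (k n : ℕ) → Vec ℕ k → Set
InΔ k n a = sum a ≡ n

-- c · e^i  (so that  vertex n i  represents e^i ∈ Δ_{k,n})
scaledUnit : ∀ {k} → Fin k → ℕ → Vec ℕ k
scaledUnit i c = replicate _ 0 [ i ]≔ c

vertex : ∀ {k} (n : ℕ) → Fin k → Vec ℕ k
vertex n i = scaledUnit i n

-- k-way cuts.  The map is given on all of ℕ^k (scaled coordinates);
-- only its values on Δ_{k,n} are ever used.

record Cut (k n : ℕ) : Set where
  field
    P      : Vec ℕ k → Fin k
    P-vert : ∀ (i : Fin k) → P (vertex n i) ≡ i
open Cut public

-- Non-opposite cuts of Δ_{3,n}.  Labels [4] are Fin 4; label j ∈ [3]
-- is  inject₁ j  (j : Fin 3), label 4 is  fromℕ 3.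

label4 : Fin 4
label4 = fromℕ 3

InSuppOr4 : Vec ℕ 3 → Fin 4 → Set
InSuppOr4 x c = c ≡ label4 ⊎ Σ (Fin 3) (λ j → c ≡ inject₁ j × ¬ (lookup x j ≡ 0))

IsNonOppositeCut : (n : ℕ) → (Vec ℕ 3 → Fin 4) → Set
IsNonOppositeCut n Q =
  (∀ (i : Fin 3) → Q (vertex n i) ≡ inject₁ i) ×
  (∀ (x : Vec ℕ 3) → InΔ 3 n x → InSuppOr4 x (Q x))

Triple : ℕ → Set
Triple k = Fin k × Fin k × Fin k

embed3 : ∀ {k} → Triple k → Vec ℕ 3 → Vec ℕ k
embed3 (i₁ , i₂ , i₃) (x₁ ∷ x₂ ∷ x₃ ∷ []) =
  zipWith _+_ (scaledUnit i₁ x₁) (zipWith _+_ (scaledUnit i₂ x₂) (scaledUnit i₃ x₃))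

restrict : ∀ {k} → (Vec ℕ k → Fin k) → Triple k → Vec ℕ 3 → Fin 4
restrict P t@(i₁ , i₂ , i₃) x with P (embed3 t x) FinP.≟ i₁
... | yes _ = Fin.zero
... | no _ with P (embed3 t x) FinP.≟ i₂
...   | yes _ = Fin.suc Fin.zero
...   | no _ with P (embed3 t x) FinP.≟ i₃
...     | yes _ = Fin.suc (Fin.suc Fin.zero)
...     | no _ = label4

-- Enumeration of Δ_{k,n} (scaled), used only to decide bounded
-- quantifiers over Δ_{k,n}; its correctness is proved below.

simplex : (k n : ℕ) → List (Vec ℕ k)
step : (k n : ℕ) → ℕ → List (Vec ℕ (suc k))
simplex zero zero = [ [] ]
simplex zero (suc n) = []
simplex (suc k) n = concatMap (step k n) (upTo (suc n))

step k n a = map (a ∷_) (simplex k (n ∸ a))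

simplex-complete : ∀ {k n} (x : Vec ℕ k) → InΔ k n x → x ∈ simplex k n
simplex-complete {zero} {zero} [] refl = here refl
simplex-complete {suc k} {n} (a ∷ xs) eq =
  ∈-concatMap⁺ (step k n) (lose (∈-upTo⁺ a<) (∈-map⁺ (a ∷_) (simplex-complete xs eq′)))
  where
  a< : a < suc n
  a< = s≤s (subst (a ≤_) eq (ℕP.m≤m+n a (sum xs)))
  eq′ : sum xs ≡ n ∸ a
  eq′ = trans (sym (ℕP.m+n∸m≡n a (sum xs))) (cong (_∸ a) eq)

simplex-sound : ∀ {k n} (x : Vec ℕ k) → x ∈ simplex k n → InΔ k n x
simplex-sound {zero} {zero} [] _ = refl
simplex-sound {zero} {suc n} [] ()
simplex-sound {suc k} {n} (a ∷ xs) mem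
  with find (∈-concatMap⁻ (step k n) {xs = upTo (suc n)} mem)
... | b , b∈ , m with ∈-map⁻ (b ∷_) m
...   | ys , ys∈ , refl =
  trans (cong (λ m → b + m) (simplex-sound ys ys∈))
        (ℕP.m+[n∸m]≡n (ℕP.≤-pred (∈-upTo⁻ b∈)))

∀Δ? : ∀ k n {P : Vec ℕ k → Set} → (∀ x → Dec (P x)) →
      Dec (∀ (x : Vec ℕ k) → InΔ k n x → P x)
∀Δ? k n P? = map′
  (λ all x inΔ → All.lookup all (simplex-complete x inΔ))
  (λ f → All.tabulate (λ {x} mem → f x (simplex-sound x mem)))
  (All.all? P? (simplex k n))

∃Δ? : ∀ k n {P : Vec ℕ k → Set} → (∀ x → Dec (P x)) →
      Dec (Σ (Vec ℕ k) (λ x → InΔ k n x × P x))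
∃Δ? k n P? = map′
  (λ any → let (x , mem , px) = find any in x , simplex-sound x mem , px)
  (λ { (x , inΔ , px) → lose (simplex-complete x inΔ) px })
  (Any.any? P? (simplex k n))

InSuppOr4? : ∀ x c → Dec (InSuppOr4 x c)
InSuppOr4? x c = (c FinP.≟ label4) ⊎-dec
  FinP.any? (λ j → (c FinP.≟ inject₁ j) ×-dec ¬? (lookup x j ℕP.≟ 0))

IsNonOppositeCut? : ∀ n Q → Dec (IsNonOppositeCut n Q)
IsNonOppositeCut? n Q =
  FinP.all? (λ i → Q (vertex n i) FinP.≟ inject₁ i) ×-dec
  ∀Δ? 3 n (λ x → InSuppOr4? x (Q x))

Distinct : ∀ {k} → Triple k → Set
Distinct (i₁ , i₂ , i₃) = ¬ i₁ ≡ i₂ × ¬ i₁ ≡ i₃ × ¬ i₂ ≡ i₃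

Distinct? : ∀ {k} (t : Triple k) → Dec (Distinct t)
Distinct? (i₁ , i₂ , i₃) =
  ¬? (i₁ FinP.≟ i₂) ×-dec ¬? (i₁ FinP.≟ i₃) ×-dec ¬? (i₂ FinP.≟ i₃)

distinctTriples : (k : ℕ) → List (Triple k)
distinctTriples k =
  filter Distinct? (cartesianProduct (allFin k) (cartesianProduct (allFin k) (allFin k)))

SuppIn2 : ∀ {k} → Vec ℕ k → Fin k → Fin k → Set
SuppIn2 x i j = ∀ m → ¬ (lookup x m ≡ 0) → m ≡ i ⊎ m ≡ j

SuppIn2? : ∀ {k} x (i j : Fin k) → Dec (SuppIn2 x i j)
SuppIn2? x i j = FinP.all? (λ m → ¬? (lookup x m ℕP.≟ 0) →-dec
                                   ((m FinP.≟ i) ⊎-dec (m FinP.≟ j)))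

InD : ∀ {k} (n : ℕ) → (Vec ℕ k → Fin k) → Fin k → Fin k → Fin k → Set
InD {k} n P i j c = Σ (Vec ℕ k) (λ x → InΔ k n x × (SuppIn2 x i j × P x ≡ c))

cardD : ∀ {k} (n : ℕ) → (Vec ℕ k → Fin k) → Fin k → Fin k → ℕ
cardD {k} n P i j =
  length (filter (λ c → ∃Δ? k n (λ x → SuppIn2? x i j ×-dec (P x FinP.≟ c))) (allFin k))

-- two-element subsets {i,j} of [k], listed as pairs with i < j
pairs : (k : ℕ) → List (Fin k × Fin k)
pairs k = filter (λ p → toℕ (proj₁ p) ℕ.<? toℕ (proj₂ p))
                 (cartesianProduct (allFin k) (allFin k))

-- a / b as a rational (b = 0 never occurs in the statement, since k ≥ 3)
_/ℕ_ : ℕ → ℕ → ℚ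
a /ℕ zero = 0ℚ
a /ℕ suc b = (ℤ+ a) / suc b

-- q / b as a rational (b = 0 never occurs in the statement, since k ≥ 3)
_÷ℕ_ : ℚ → ℕ → ℚ
q ÷ℕ zero = 0ℚ
q ÷ℕ suc b = q ℚ.* ((ℤ+ 1) / suc b)

D : ∀ {k n} → Cut k n → ℚ
D {k} {n} C =
  sumℕ (map (λ p → cardD n (P C) (proj₁ p) (proj₂ p)) (pairs k)) /ℕ length (pairs k)

-- Pr over a uniformly random ordered triple of distinct elements of [k]
-- that P_(i1,i2,i3) is a non-opposite cut of Δ_{3,n}.

probNonOpposite : ∀ {k n} → Cut k n → ℚ
probNonOpposite {k} {n} C =
  length (filter (λ t → IsNonOppositeCut? n (restrict (P C) t)) (distinctTriples k))
  /ℕ length (distinctTriples k)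

-- A distinct triple (a, b, c) fails to restrict to a non-opposite cut only if some point x of the
-- face spanned by e^a, e^b, e^c gets a label among a, b, c, say a, with x_a = 0; then x lies on the
-- side spanned by e^b, e^c, so a ∈ D_{b,c}.  Hence the number of failing ordered triples is at most
-- 3E, where E counts ordered distinct triples (a, b, c) with c ∈ D_{a,b}.  As a, b ∈ D_{a,b} always,
-- the pair {a, b} contributes at most 2(|D_{a,b}| − 2) to E, so E ≤ 2·C(k,2)·(D(P) − 2), while there
-- are 2·C(k,2)·(k − 2) ordered distinct triples.
module Submission where

open import Defs

module Sums where

  open import Data.Nat using (ℕ; zero; suc; _+_; _*_; _≤_; z≤n; s≤s)
  import Data.Nat.Properties as ℕP
  open import Data.Nat.ListAction using (sum)
  open import Data.Fin using (Fin)
  import Data.Fin.Properties as FinP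
  open import Data.List using (List; []; _∷_; map; filter; length; cartesianProduct; allFin; tabulate; _++_)
  open import Data.Nat.ListAction.Properties using (sum-++)
  open import Data.List.Properties using (map-++; map-∘; map-tabulate)
  open import Data.Product using (_×_; _,_)
  open import Function using (_∘_)
  open import Data.Bool using (if_then_else_)
  open import Relation.Nullary using (Dec; does; yes; no; ¬_; contradiction)
  open import Relation.Unary using (Decidable)
  open import Relation.Binary.PropositionalEquality
  open import Algebra.Properties.Semiring.Sum ℕP.+-*-semiring public
    using (sum-syntax; ∑-comm; ∑-distrib-+; *-distribʳ-sum; sum-cong-≗; sum-replicate-zero)

  -- Defined through `does` alone so that it computes through `map′`, as in `suc x ≟ suc y`.
  𝟙 : ∀ {a} {A : Set a} → Dec A → ℕ
  𝟙 p = if does p then 1 else 0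

  module _ {a b} {A : Set a} {B : Set b} where

    𝟙-cong : (p : Dec A) (q : Dec B) → (A → B) → (B → A) → 𝟙 p ≡ 𝟙 q
    𝟙-cong (yes _) (yes _) _ _ = refl
    𝟙-cong (yes x) (no ¬y) f _ = contradiction (f x) ¬y
    𝟙-cong (no ¬x) (yes y) _ g = contradiction (g y) ¬x
    𝟙-cong (no _)  (no _)  _ _ = refl

  module _ {a} {A : Set a} where

    1≤𝟙 : (p : Dec A) → A → 1 ≤ 𝟙 p
    1≤𝟙 (yes _) _ = s≤s z≤n
    1≤𝟙 (no ¬x) x = contradiction x ¬x

    𝟙-yes : (p : Dec A) → A → 𝟙 p ≡ 1
    𝟙-yes (yes _) _ = refl
    𝟙-yes (no ¬x) x = contradiction x ¬x

    𝟙-no : (p : Dec A) → ¬ A → 𝟙 p ≡ 0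
    𝟙-no (yes x) ¬x = contradiction x ¬x
    𝟙-no (no _)  _  = refl

    𝟙-*-≤ : ∀ (p : Dec A) x → 𝟙 p * x ≤ x
    𝟙-*-≤ (yes _) x = ℕP.≤-reflexive (ℕP.+-identityʳ x)
    𝟙-*-≤ (no _)  _ = z≤n

    𝟙-*-cong : ∀ (p : Dec A) {x y} → (A → x ≡ y) → 𝟙 p * x ≡ 𝟙 p * y
    𝟙-*-cong (yes a) x≡y = cong (1 *_) (x≡y a)
    𝟙-*-cong (no _)  _   = refl

    𝟙-*-mono : ∀ (p : Dec A) {x y} → (A → x ≤ y) → 𝟙 p * x ≤ 𝟙 p * y
    𝟙-*-mono (yes a) x≤y = ℕP.*-monoʳ-≤ 1 (x≤y a)
    𝟙-*-mono (no _)  _   = z≤n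

  ∑-mono-≤ : ∀ {k} {f g : Fin k → ℕ} → (∀ i → f i ≤ g i) → ∑[ i < k ] f i ≤ ∑[ i < k ] g i
  ∑-mono-≤ {zero}  f≤g = z≤n
  ∑-mono-≤ {suc k} f≤g = ℕP.+-mono-≤ (f≤g Fin.zero) (∑-mono-≤ (f≤g ∘ Fin.suc))

  ∑-1 : ∀ k → ∑[ i < k ] 1 ≡ k
  ∑-1 zero    = refl
  ∑-1 (suc k) = cong suc (∑-1 k)

  ∑-𝟙-≟ : ∀ {k} (a : Fin k) → ∑[ c < k ] 𝟙 (c FinP.≟ a) ≡ 1
  ∑-𝟙-≟ {suc k} Fin.zero    = cong suc (sum-replicate-zero k)
  ∑-𝟙-≟ {suc k} (Fin.suc a) = ∑-𝟙-≟ a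

  sum-tabulate : ∀ {k} (f : Fin k → ℕ) → sum (tabulate f) ≡ ∑[ i < k ] f i
  sum-tabulate {zero}  f = refl
  sum-tabulate {suc k} f = cong (f Fin.zero +_) (sum-tabulate (f ∘ Fin.suc))

  sum-map-allFin : ∀ k (f : Fin k → ℕ) → sum (map f (allFin k)) ≡ ∑[ i < k ] f i
  sum-map-allFin k f = trans (cong sum (map-tabulate (λ i → i) f)) (sum-tabulate f)

  module _ {a b} {A : Set a} {B : Set b} where

    sum-map-cartesianProduct : ∀ (xs : List A) (ys : List B) (f : A × B → ℕ) →
      sum (map f (cartesianProduct xs ys)) ≡ sum (map (λ x → sum (map (λ y → f (x , y)) ys)) xs)
    sum-map-cartesianProduct []       ys f = refl
    sum-map-cartesianProduct (x ∷ xs) ys f = begin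
      sum (map f (map (x ,_) ys ++ cartesianProduct xs ys))
        ≡⟨ cong sum (map-++ f (map (x ,_) ys) _) ⟩
      sum (map f (map (x ,_) ys) ++ map f (cartesianProduct xs ys))
        ≡⟨ sum-++ (map f (map (x ,_) ys)) _ ⟩
      sum (map f (map (x ,_) ys)) + sum (map f (cartesianProduct xs ys))
        ≡⟨ cong₂ _+_ (cong sum (sym (map-∘ ys))) (sum-map-cartesianProduct xs ys f) ⟩
      sum (map (λ y → f (x , y)) ys) + sum (map (λ x → sum (map (λ y → f (x , y)) ys)) xs) ∎
      where open ≡-Reasoning

  module _ {a q} {A : Set a} {Q : A → Set q} (Q? : Decidable Q) where

    length-filter≡∑𝟙 : ∀ xs → length (filter Q? xs) ≡ sum (map (𝟙 ∘ Q?) xs)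
    length-filter≡∑𝟙 []       = refl
    length-filter≡∑𝟙 (x ∷ xs) with Q? x
    ... | yes _ = cong suc (length-filter≡∑𝟙 xs)
    ... | no _  = length-filter≡∑𝟙 xs

    sum-map-filter : ∀ (f : A → ℕ) xs → sum (map f (filter Q? xs)) ≡ sum (map (λ x → 𝟙 (Q? x) * f x) xs)
    sum-map-filter f []       = refl
    sum-map-filter f (x ∷ xs) with Q? x
    ... | yes _ = cong₂ _+_ (sym (ℕP.+-identityʳ (f x))) (sum-map-filter f xs)
    ... | no _  = sum-map-filter f xs

module Restriction where

  open import Data.Nat using (ℕ; zero; suc; _+_)
  import Data.Nat.Properties as ℕP
  open import Data.Fin using (Fin; inject₁)
  open import Data.Fin.Patterns using (0F; 1F; 2F)
  import Data.Fin.Properties as FinP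
  open import Data.Vec using (Vec; []; _∷_; lookup; sum; replicate; zipWith; _[_]≔_)
  import Data.Vec.Properties as VecP
  open import Data.Product using (∃; _×_; _,_; proj₁; proj₂)
  open import Data.Sum using (_⊎_; inj₁; inj₂)
  open import Relation.Nullary using (yes; no; contradiction)
  open import Relation.Nullary.Decidable using (¬?; decidable-stable)
  open import Relation.Binary.PropositionalEquality
  open import Function using (_∘_)
  import Data.Sum as Sum
  open import Algebra.Properties.CommutativeSemigroup ℕP.+-commutativeSemigroup using (interchange)

  corner : ∀ {k} → Triple k → Fin 3 → Fin k
  corner (i₁ , i₂ , i₃) 0F = i₁
  corner (i₁ , i₂ , i₃) 1F = i₂
  corner (i₁ , i₂ , i₃) 2F = i₃

  oppositeSide : ∀ {k} → Triple k → Fin 3 → Fin k × Fin k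
  oppositeSide (i₁ , i₂ , i₃) 0F = i₂ , i₃
  oppositeSide (i₁ , i₂ , i₃) 1F = i₁ , i₃
  oppositeSide (i₁ , i₂ , i₃) 2F = i₁ , i₂

  corner-oppositeSide : ∀ {k} (t : Triple k) {j j′ : Fin 3} → j′ ≢ j →
                        corner t j′ ≡ proj₁ (oppositeSide t j) ⊎ corner t j′ ≡ proj₂ (oppositeSide t j)
  corner-oppositeSide t {0F} {0F} j′≢j = contradiction refl j′≢j
  corner-oppositeSide t {0F} {1F} _    = inj₁ refl
  corner-oppositeSide t {0F} {2F} _    = inj₂ refl
  corner-oppositeSide t {1F} {0F} _    = inj₁ refl
  corner-oppositeSide t {1F} {1F} j′≢j = contradiction refl j′≢j
  corner-oppositeSide t {1F} {2F} _    = inj₂ refl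
  corner-oppositeSide t {2F} {0F} _    = inj₁ refl
  corner-oppositeSide t {2F} {1F} _    = inj₂ refl
  corner-oppositeSide t {2F} {2F} j′≢j = contradiction refl j′≢j

  +≢0 : ∀ {x y : ℕ} → x + y ≢ 0 → x ≢ 0 ⊎ y ≢ 0
  +≢0 {zero}  y≢0 = inj₂ y≢0
  +≢0 {suc x} _   = inj₁ λ ()

  lookup-scaledUnit-≢0 : ∀ {k} (i m : Fin k) c → lookup (scaledUnit i c) m ≢ 0 → m ≡ i × c ≢ 0
  lookup-scaledUnit-≢0 i m c ≢0 with i FinP.≟ m
  ... | yes refl = refl , subst (_≢ 0) (VecP.lookup∘update i (replicate _ 0) c) ≢0
  ... | no i≢m   = contradiction (trans (VecP.lookup∘update′ (i≢m ∘ sym) (replicate _ 0) c)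
                                        (VecP.lookup-replicate m 0)) ≢0

  scaledUnit-zero : ∀ {k} (i : Fin k) → scaledUnit i 0 ≡ replicate k 0
  scaledUnit-zero {k} i = trans (cong (replicate k 0 [ i ]≔_) (sym (VecP.lookup-replicate i 0)))
                                (VecP.[]≔-lookup (replicate k 0) i)

  sum-scaledUnit : ∀ {k} (i : Fin k) c → sum (scaledUnit i c) ≡ c
  sum-scaledUnit {suc k} 0F        c = trans (cong (c +_) (sum-replicate-zero k)) (ℕP.+-identityʳ c)
    where
    sum-replicate-zero : ∀ k → sum (replicate k 0) ≡ 0
    sum-replicate-zero zero    = refl
    sum-replicate-zero (suc k) = sum-replicate-zero k
  sum-scaledUnit {suc k} (Fin.suc i) c = sum-scaledUnit i c

  sum-zipWith-+ : ∀ {k} (u v : Vec ℕ k) → sum (zipWith _+_ u v) ≡ sum u + sum v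
  sum-zipWith-+ []      []      = refl
  sum-zipWith-+ (x ∷ u) (y ∷ v) = trans (cong (x + y +_) (sum-zipWith-+ u v)) (interchange x y (sum u) (sum v))

  embed3-InΔ : ∀ {k n} (t : Triple k) x → InΔ 3 n x → InΔ k n (embed3 t x)
  embed3-InΔ (a , b , c) (x₁ ∷ x₂ ∷ x₃ ∷ []) refl = begin
    sum (zipWith _+_ (scaledUnit a x₁) (zipWith _+_ (scaledUnit b x₂) (scaledUnit c x₃)))
      ≡⟨ sum-zipWith-+ (scaledUnit a x₁) _ ⟩
    sum (scaledUnit a x₁) + sum (zipWith _+_ (scaledUnit b x₂) (scaledUnit c x₃))
      ≡⟨ cong (sum (scaledUnit a x₁) +_) (sum-zipWith-+ (scaledUnit b x₂) _) ⟩
    sum (scaledUnit a x₁) + (sum (scaledUnit b x₂) + sum (scaledUnit c x₃))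
      ≡⟨ cong₂ _+_ (sum-scaledUnit a x₁) (cong₂ _+_ (sum-scaledUnit b x₂) (sum-scaledUnit c x₃)) ⟩
    x₁ + (x₂ + x₃)
      ≡⟨ cong (λ z → x₁ + (x₂ + z)) (sym (ℕP.+-identityʳ x₃)) ⟩
    x₁ + (x₂ + (x₃ + 0)) ∎
    where open ≡-Reasoning

  embed3-support : ∀ {k} (t : Triple k) x (m : Fin k) → lookup (embed3 t x) m ≢ 0 →
                   ∃ λ j → m ≡ corner t j × lookup x j ≢ 0
  embed3-support (a , b , c) (x₁ ∷ x₂ ∷ x₃ ∷ []) m ≢0
    with +≢0 (subst (_≢ 0) lookup-embed3 ≢0)
    where
    lookup-embed3 : lookup (embed3 (a , b , c) (x₁ ∷ x₂ ∷ x₃ ∷ [])) m ≡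
                    lookup (scaledUnit a x₁) m + (lookup (scaledUnit b x₂) m + lookup (scaledUnit c x₃) m)
    lookup-embed3 = trans (VecP.lookup-zipWith _+_ m (scaledUnit a x₁) _)
                          (cong (lookup (scaledUnit a x₁) m +_) (VecP.lookup-zipWith _+_ m (scaledUnit b x₂) _))
  ... | inj₁ ≢0₁ = 0F , lookup-scaledUnit-≢0 a m x₁ ≢0₁
  ... | inj₂ ≢0₂₃ with +≢0 ≢0₂₃
  ...   | inj₁ ≢0₂ = 1F , lookup-scaledUnit-≢0 b m x₂ ≢0₂
  ...   | inj₂ ≢0₃ = 2F , lookup-scaledUnit-≢0 c m x₃ ≢0₃

  embed3-vertex : ∀ {k} n (t : Triple k) (j : Fin 3) → embed3 t (vertex n j) ≡ vertex n (corner t j)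
  embed3-vertex n (a , b , c) 0F rewrite scaledUnit-zero b | scaledUnit-zero c =
    trans (cong (zipWith _+_ (scaledUnit a n)) (VecP.zipWith-identityˡ ℕP.+-identityˡ _))
          (VecP.zipWith-identityʳ ℕP.+-identityʳ _)
  embed3-vertex n (a , b , c) 1F rewrite scaledUnit-zero a | scaledUnit-zero c =
    trans (VecP.zipWith-identityˡ ℕP.+-identityˡ _) (VecP.zipWith-identityʳ ℕP.+-identityʳ _)
  embed3-vertex n (a , b , c) 2F rewrite scaledUnit-zero a | scaledUnit-zero b =
    trans (VecP.zipWith-identityˡ ℕP.+-identityˡ _) (VecP.zipWith-identityˡ ℕP.+-identityˡ _)

  module _ {k} (cut : Vec ℕ k → Fin k) where

    restrict-spec : ∀ t x → restrict cut t x ≡ label4 ⊎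
                    ∃ λ j → restrict cut t x ≡ inject₁ j × cut (embed3 t x) ≡ corner t j
    restrict-spec t@(a , b , c) x with cut (embed3 t x) FinP.≟ a
    ... | yes ≡a = inj₂ (0F , refl , ≡a)
    ... | no _ with cut (embed3 t x) FinP.≟ b
    ...   | yes ≡b = inj₂ (1F , refl , ≡b)
    ...   | no _ with cut (embed3 t x) FinP.≟ c
    ...     | yes ≡c = inj₂ (2F , refl , ≡c)
    ...     | no _   = inj₁ refl

    restrict-corner : ∀ t x j → Distinct t → cut (embed3 t x) ≡ corner t j → restrict cut t x ≡ inject₁ j
    restrict-corner t@(a , b , c) x 0F _ ≡a with cut (embed3 t x) FinP.≟ a
    ... | yes _  = refl
    ... | no ≢a  = contradiction ≡a ≢a
    restrict-corner t@(a , b , c) x 1F (a≢b , _) ≡b with cut (embed3 t x) FinP.≟ a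
    ... | yes ≡a = contradiction (trans (sym ≡a) ≡b) a≢b
    ... | no _ with cut (embed3 t x) FinP.≟ b
    ...   | yes _  = refl
    ...   | no ≢b  = contradiction ≡b ≢b
    restrict-corner t@(a , b , c) x 2F (_ , a≢c , b≢c) ≡c with cut (embed3 t x) FinP.≟ a
    ... | yes ≡a = contradiction (trans (sym ≡a) ≡c) a≢c
    ... | no _ with cut (embed3 t x) FinP.≟ b
    ...   | yes ≡b = contradiction (trans (sym ≡b) ≡c) b≢c
    ...   | no _ with cut (embed3 t x) FinP.≟ c
    ...     | yes _  = refl
    ...     | no ≢c  = contradiction ≡c ≢c

  restrict-nonOpposite⊎cornerOnSide : ∀ {k n} (C : Cut k n) t → Distinct t →
    IsNonOppositeCut n (restrict (P C) t) ⊎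
    ∃ λ j → InD n (P C) (proj₁ (oppositeSide t j)) (proj₂ (oppositeSide t j)) (corner t j)
  restrict-nonOpposite⊎cornerOnSide {k} {n} C t distinct
    with ∃Δ? 3 n (λ x → ¬? (InSuppOr4? x (restrict (P C) t x)))
  ... | no noBadPoint = inj₁ (vertices , λ x x∈Δ →
          decidable-stable (InSuppOr4? x _) (λ bad → noBadPoint (x , x∈Δ , bad)))
    where
    vertices : ∀ j → restrict (P C) t (vertex n j) ≡ inject₁ j
    vertices j = restrict-corner (P C) t _ j distinct
                   (trans (cong (P C) (embed3-vertex n t j)) (P-vert C (corner t j)))
  ... | yes (x , x∈Δ , bad) with restrict-spec (P C) t x
  ...   | inj₁ ≡label4          = contradiction (inj₁ ≡label4) bad
  ...   | inj₂ (j , ≡j , P≡corner) =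
          inj₂ (j , embed3 t x , embed3-InΔ t x x∈Δ , onSide , P≡corner)
    where
    xⱼ≡0 : lookup x j ≡ 0
    xⱼ≡0 = decidable-stable (lookup x j ℕP.≟ 0) (λ xⱼ≢0 → bad (inj₂ (j , ≡j , xⱼ≢0)))
    onSide : SuppIn2 (embed3 t x) (proj₁ (oppositeSide t j)) (proj₂ (oppositeSide t j))
    onSide m ≢0 with embed3-support t x m ≢0
    ... | j′ , m≡ , xⱼ′≢0 = Sum.map (trans m≡) (trans m≡)
                              (corner-oppositeSide t λ j′≡j →
                                 xⱼ′≢0 (subst (λ i → lookup x i ≡ 0) (sym j′≡j) xⱼ≡0))

module Counting where

  open Sums
  open Restriction using (restrict-nonOpposite⊎cornerOnSide; sum-scaledUnit; lookup-scaledUnit-≢0)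
  open import Data.Nat as ℕ using (ℕ; _+_; _*_; _≤_; _<?_)
  import Data.Nat.Properties as ℕP
  open import Data.Nat.ListAction using (sum)
  open import Data.Fin using (Fin; toℕ)
  open import Data.Fin.Patterns using (0F; 1F; 2F)
  import Data.Fin.Properties as FinP
  open import Data.Vec using (Vec)
  open import Data.List using (List; map; filter; length; cartesianProduct; allFin)
  open import Data.Product using (_×_; _,_; proj₁; proj₂)
  open import Data.Sum using (inj₁; inj₂)
  import Data.Sum as Sum
  open import Function using (_∘_)
  open import Relation.Binary using (tri<; tri≈; tri>)
  open import Relation.Nullary using (Dec; yes; no; contradiction)
  open import Relation.Nullary.Decidable using (_×-dec_)
  open import Relation.Unary using (Decidable)
  open import Relation.Binary.PropositionalEquality
  open import Data.Nat.Solver using (module +-*-Solver)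

  module Indices (k : ℕ) where

    ∑₂ : (Fin k → Fin k → ℕ) → ℕ
    ∑₂ f = ∑[ a < k ] ∑[ b < k ] f a b

    ∑₃ : (Fin k → Fin k → Fin k → ℕ) → ℕ
    ∑₃ f = ∑[ a < k ] ∑[ b < k ] ∑[ c < k ] f a b c

    ∑₂-cong : ∀ {f g} → (∀ a b → f a b ≡ g a b) → ∑₂ f ≡ ∑₂ g
    ∑₂-cong f≡g = sum-cong-≗ (λ a → sum-cong-≗ (f≡g a))

    ∑₃-cong : ∀ {f g} → (∀ a b c → f a b c ≡ g a b c) → ∑₃ f ≡ ∑₃ g
    ∑₃-cong f≡g = sum-cong-≗ (λ a → ∑₂-cong (f≡g a))

    ∑₂-mono-≤ : ∀ {f g} → (∀ a b → f a b ≤ g a b) → ∑₂ f ≤ ∑₂ g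
    ∑₂-mono-≤ f≤g = ∑-mono-≤ (λ a → ∑-mono-≤ (f≤g a))

    ∑₃-mono-≤ : ∀ {f g} → (∀ a b c → f a b c ≤ g a b c) → ∑₃ f ≤ ∑₃ g
    ∑₃-mono-≤ f≤g = ∑-mono-≤ (λ a → ∑₂-mono-≤ (f≤g a))

    ∑₂-distrib-+ : ∀ f g → ∑₂ (λ a b → f a b + g a b) ≡ ∑₂ f + ∑₂ g
    ∑₂-distrib-+ f g = trans (sum-cong-≗ (λ a → ∑-distrib-+ (f a) (g a)))
                             (∑-distrib-+ (λ a → ∑[ b < k ] f a b) (λ a → ∑[ b < k ] g a b))

    ∑₃-distrib-+ : ∀ f g → ∑₃ (λ a b c → f a b c + g a b c) ≡ ∑₃ f + ∑₃ g
    ∑₃-distrib-+ f g = trans (sum-cong-≗ (λ a → ∑₂-distrib-+ (f a) (g a)))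
                             (∑-distrib-+ (λ a → ∑₂ (f a)) (λ a → ∑₂ (g a)))

    ∑₂-*ʳ : ∀ f x → ∑₂ (λ a b → f a b * x) ≡ ∑₂ f * x
    ∑₂-*ʳ f x = sym (trans (*-distribʳ-sum x (λ a → ∑[ b < k ] f a b))
                           (sum-cong-≗ (λ a → *-distribʳ-sum x (f a))))

    ∑₃-swap₂₃ : ∀ f → ∑₃ (λ a b c → f a c b) ≡ ∑₃ f
    ∑₃-swap₂₃ f = sum-cong-≗ (λ a → ∑-comm (λ b c → f a c b))

    ∑₃-rotate : ∀ f → ∑₃ (λ a b c → f b c a) ≡ ∑₃ f
    ∑₃-rotate f = trans (∑-comm (λ a b → ∑[ c < k ] f b c a))
                        (sum-cong-≗ (λ b → ∑-comm (λ a c → f b c a)))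

    ∑-+-𝟙-≟ : ∀ (f : Fin k → ℕ) a b →
              ∑[ c < k ] (f c + (𝟙 (c FinP.≟ a) + 𝟙 (c FinP.≟ b))) ≡ ∑[ c < k ] f c + 2
    ∑-+-𝟙-≟ f a b = begin
      ∑[ c < k ] (f c + (𝟙 (c FinP.≟ a) + 𝟙 (c FinP.≟ b)))
        ≡⟨ ∑-distrib-+ f (λ c → 𝟙 (c FinP.≟ a) + 𝟙 (c FinP.≟ b)) ⟩
      ∑[ c < k ] f c + ∑[ c < k ] (𝟙 (c FinP.≟ a) + 𝟙 (c FinP.≟ b))
        ≡⟨ cong (∑[ c < k ] f c +_) (trans (∑-distrib-+ (λ c → 𝟙 (c FinP.≟ a)) (λ c → 𝟙 (c FinP.≟ b)))
                                              (cong₂ _+_ (∑-𝟙-≟ a) (∑-𝟙-≟ b))) ⟩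
      ∑[ c < k ] f c + 2 ∎
      where open ≡-Reasoning

    below : Fin k → Fin k → ℕ
    below a b = 𝟙 (toℕ a <? toℕ b)

    below-+-below : ∀ {a b} → a ≢ b → below a b + below b a ≡ 1
    below-+-below {a} {b} a≢b with ℕP.<-cmp (toℕ a) (toℕ b)
    ... | tri< a<b _ b≮a = cong₂ _+_ (𝟙-yes (toℕ a <? toℕ b) a<b) (𝟙-no (toℕ b <? toℕ a) b≮a)
    ... | tri≈ _ a≡b _   = contradiction (FinP.toℕ-injective a≡b) a≢b
    ... | tri> a≮b _ b<a = cong₂ _+_ (𝟙-no (toℕ a <? toℕ b) a≮b) (𝟙-yes (toℕ b <? toℕ a) b<a)

    below-≢ : ∀ {a b : Fin k} → toℕ a ℕ.< toℕ b → a ≢ b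
    below-≢ a<b refl = ℕP.<-irrefl refl a<b

    ∑₂-symmetric : ∀ h → (∀ a b → h a b ≡ h b a) → (∀ a → h a a ≡ 0) →
                   ∑₂ h ≡ 2 * ∑₂ (λ a b → below a b * h a b)
    ∑₂-symmetric h h-sym h-diag = begin
      ∑₂ h
        ≡⟨ ∑₂-cong split ⟩
      ∑₂ (λ a b → (below a b + below b a) * h a b)
        ≡⟨ ∑₂-cong (λ a b → ℕP.*-distribʳ-+ (h a b) (below a b) (below b a)) ⟩
      ∑₂ (λ a b → below a b * h a b + below b a * h a b)
        ≡⟨ ∑₂-distrib-+ (λ a b → below a b * h a b) (λ a b → below b a * h a b) ⟩
      X + ∑₂ (λ a b → below b a * h a b)
        ≡⟨ cong (X +_) (trans (∑-comm (λ a b → below b a * h a b))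
                              (∑₂-cong (λ b a → cong (below b a *_) (h-sym a b)))) ⟩
      X + X
        ≡⟨ cong (X +_) (sym (ℕP.+-identityʳ X)) ⟩
      2 * X ∎
      where
      open ≡-Reasoning
      X = ∑₂ (λ a b → below a b * h a b)
      split : ∀ a b → h a b ≡ (below a b + below b a) * h a b
      split a b with a FinP.≟ b
      ... | yes refl = trans (h-diag a) (sym (trans (cong ((below a a + below a a) *_) (h-diag a))
                                                               (ℕP.*-zeroʳ (below a a + below a a))))
      ... | no a≢b   = sym (trans (cong (_* h a b) (below-+-below a≢b)) (ℕP.+-identityʳ (h a b)))

    distinct : Fin k → Fin k → Fin k → ℕ
    distinct a b c = 𝟙 (Distinct? (a , b , c))

    distinct-≡₁₂ : ∀ a c → distinct a a c ≡ 0
    distinct-≡₁₂ a c = 𝟙-no (Distinct? (a , a , c)) (λ (a≢a , _) → a≢a refl)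

    distinct-≡₁₃ : ∀ a b → distinct a b a ≡ 0
    distinct-≡₁₃ a b = 𝟙-no (Distinct? (a , b , a)) (λ (_ , a≢a , _) → a≢a refl)

    distinct-≡₂₃ : ∀ a b → distinct a b b ≡ 0
    distinct-≡₂₃ a b = 𝟙-no (Distinct? (a , b , b)) (λ (_ , _ , b≢b) → b≢b refl)

    distinct-swap₁₂ : ∀ a b c → distinct b a c ≡ distinct a b c
    distinct-swap₁₂ a b c = 𝟙-cong (Distinct? (b , a , c)) (Distinct? (a , b , c)) swap swap
      where
      swap : ∀ {x y : Fin k} → Distinct (x , y , c) → Distinct (y , x , c)
      swap (x≢y , x≢c , y≢c) = ≢-sym x≢y , y≢c , x≢c

    distinct-swap₂₃ : ∀ a b c → distinct a c b ≡ distinct a b c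
    distinct-swap₂₃ a b c = 𝟙-cong (Distinct? (a , c , b)) (Distinct? (a , b , c)) swap swap
      where
      swap : ∀ {x y : Fin k} → Distinct (a , x , y) → Distinct (a , y , x)
      swap (a≢x , a≢y , x≢y) = a≢y , a≢x , ≢-sym x≢y

    distinct-rotate : ∀ a b c → distinct b c a ≡ distinct a b c
    distinct-rotate a b c = 𝟙-cong (Distinct? (b , c , a)) (Distinct? (a , b , c))
      (λ (b≢c , b≢a , c≢a) → ≢-sym b≢a , ≢-sym c≢a , b≢c)
      (λ (a≢b , a≢c , b≢c) → b≢c , ≢-sym a≢b , ≢-sym a≢c)

    distinct-+-𝟙-≟ : ∀ {a b} → a ≢ b → ∀ c → distinct a b c + (𝟙 (c FinP.≟ a) + 𝟙 (c FinP.≟ b)) ≡ 1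
    distinct-+-𝟙-≟ {a} {b} a≢b c with c FinP.≟ a | c FinP.≟ b
    ... | yes refl | yes refl = contradiction refl a≢b
    ... | yes refl | no _     = cong (_+ 1) (distinct-≡₁₃ a b)
    ... | no _     | yes refl = cong (_+ 1) (distinct-≡₂₃ a b)
    ... | no c≢a   | no c≢b   = trans (ℕP.+-identityʳ (distinct a b c))
                                      (𝟙-yes (Distinct? (a , b , c)) (a≢b , ≢-sym c≢a , ≢-sym c≢b))

    ∑-distinct : ∀ j → k ≡ 2 + j → ∀ {a b} → a ≢ b → ∑[ c < k ] distinct a b c ≡ j
    ∑-distinct j k≡2+j {a} {b} a≢b = ℕP.+-cancelʳ-≡ _ _ _ (begin
      ∑[ c < k ] distinct a b c + 2                                  ≡⟨ ∑-+-𝟙-≟ (distinct a b) a b ⟨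
      ∑[ c < k ] (distinct a b c + (𝟙 (c FinP.≟ a) + 𝟙 (c FinP.≟ b))) ≡⟨ sum-cong-≗ (distinct-+-𝟙-≟ a≢b) ⟩
      ∑[ c < k ] 1                                                   ≡⟨ ∑-1 k ⟩
      k                                                              ≡⟨ trans k≡2+j (ℕP.+-comm 2 j) ⟩
      j + 2                                                          ∎)
      where open ≡-Reasoning

    ∑₃-distinct : ∀ j → k ≡ 2 + j → ∑₃ distinct ≡ 2 * ∑₂ below * j
    ∑₃-distinct j k≡2+j = begin
      ∑₃ distinct
        ≡⟨ ∑₂-symmetric (λ a b → ∑[ c < k ] distinct a b c)
             (λ a b → sum-cong-≗ (λ c → sym (distinct-swap₁₂ a b c)))
             (λ a → trans (sum-cong-≗ (distinct-≡₁₂ a)) (sum-replicate-zero k)) ⟩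
      2 * ∑₂ (λ a b → below a b * ∑[ c < k ] distinct a b c)
        ≡⟨ cong (2 *_) (∑₂-cong (λ a b → 𝟙-*-cong (toℕ a <? toℕ b) (∑-distinct j k≡2+j ∘ below-≢))) ⟩
      2 * ∑₂ (λ a b → below a b * j)
        ≡⟨ cong (2 *_) (∑₂-*ʳ below j) ⟩
      2 * (∑₂ below * j)
        ≡⟨ ℕP.*-assoc 2 (∑₂ below) j ⟨
      2 * ∑₂ below * j ∎
      where open ≡-Reasoning

    square : List (Fin k × Fin k)
    square = cartesianProduct (allFin k) (allFin k)

    cube : List (Triple k)
    cube = cartesianProduct (allFin k) square

    below? : Decidable (λ (p : Fin k × Fin k) → toℕ (proj₁ p) ℕ.< toℕ (proj₂ p))
    below? (a , b) = toℕ a <? toℕ b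

    sum-map-square : ∀ (f : Fin k × Fin k → ℕ) →
                     sum (map f square) ≡ ∑₂ (λ a b → f (a , b))
    sum-map-square f = trans (sum-map-cartesianProduct (allFin k) (allFin k) f)
                             (trans (sum-map-allFin k (λ a → sum (map (λ b → f (a , b)) (allFin k))))
                                    (sum-cong-≗ (λ a → sum-map-allFin k (λ b → f (a , b)))))

    sum-map-cube : ∀ (f : Triple k → ℕ) →
                   sum (map f cube) ≡ ∑₃ (λ a b c → f (a , b , c))
    sum-map-cube f = trans (sum-map-cartesianProduct (allFin k) square f)
                           (trans (sum-map-allFin k (λ a → sum (map (λ bc → f (a , bc)) square)))
                                  (sum-cong-≗ (λ a → sum-map-square (λ bc → f (a , bc)))))

    length-distinctTriples : length (distinctTriples k) ≡ ∑₃ distinct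
    length-distinctTriples = trans (length-filter≡∑𝟙 Distinct? cube) (sum-map-cube (𝟙 ∘ Distinct?))

    length-filter-distinctTriples : ∀ {q} {Q : Triple k → Set q} (Q? : Decidable Q) →
      length (filter Q? (distinctTriples k)) ≡ ∑₃ (λ a b c → distinct a b c * 𝟙 (Q? (a , b , c)))
    length-filter-distinctTriples Q? =
      trans (length-filter≡∑𝟙 Q? (distinctTriples k))
            (trans (sum-map-filter Distinct? (𝟙 ∘ Q?) cube) (sum-map-cube (λ t → 𝟙 (Distinct? t) * 𝟙 (Q? t))))

    length-pairs : length (pairs k) ≡ ∑₂ below
    length-pairs = trans (length-filter≡∑𝟙 below? square) (sum-map-square (𝟙 ∘ below?))

    sum-map-pairs : ∀ f → sum (map f (pairs k)) ≡ ∑₂ (λ a b → below a b * f (a , b))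
    sum-map-pairs f = trans (sum-map-filter below? f square) (sum-map-square (λ p → 𝟙 (below? p) * f p))

  InD? : ∀ {k} n (cut : Vec ℕ k → Fin k) a b c → Dec (InD n cut a b c)
  InD? {k} n cut a b c = ∃Δ? k n (λ x → SuppIn2? x a b ×-dec (cut x FinP.≟ c))

  InD-swap : ∀ {k n} {cut : Vec ℕ k → Fin k} {a b c} → InD n cut a b c → InD n cut b a c
  InD-swap (x , x∈Δ , onSide , Px≡c) = x , x∈Δ , (λ m ≢0 → Sum.swap (onSide m ≢0)) , Px≡c

  InD-vertex : ∀ {k n} (C : Cut k n) a b → InD n (P C) a b a
  InD-vertex {n = n} C a b =
    vertex n a , sum-scaledUnit a n , (λ m ≢0 → inj₁ (proj₁ (lookup-scaledUnit-≢0 a m n ≢0))) , P-vert C a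

  module _ {k n} (C : Cut k n) where

    open Indices k

    inD : Fin k → Fin k → Fin k → ℕ
    inD a b c = 𝟙 (InD? n (P C) a b c)

    nonOpposite : Fin k → Fin k → Fin k → ℕ
    nonOpposite a b c = 𝟙 (IsNonOppositeCut? n (restrict (P C) (a , b , c)))

    cardD≡∑inD : ∀ a b → cardD n (P C) a b ≡ ∑[ c < k ] inD a b c
    cardD≡∑inD a b = trans (length-filter≡∑𝟙 (InD? n (P C) a b) (allFin k)) (sum-map-allFin k (inD a b))

    extraLabels : ℕ
    extraLabels = ∑₃ (λ a b c → distinct a b c * inD a b c)

    1≤nonOpposite+inD : ∀ a b c → Distinct (a , b , c) →
                        1 ≤ nonOpposite a b c + (inD b c a + (inD a c b + inD a b c))
    1≤nonOpposite+inD a b c d with restrict-nonOpposite⊎cornerOnSide C (a , b , c) d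
    ... | inj₁ nonOpp   = ℕP.m≤n⇒m≤n+o _ (1≤𝟙 (IsNonOppositeCut? n (restrict (P C) (a , b , c))) nonOpp)
    ... | inj₂ (0F , h) = ℕP.m≤n⇒m≤o+n (nonOpposite a b c) (ℕP.m≤n⇒m≤n+o _ (1≤𝟙 (InD? n (P C) b c a) h))
    ... | inj₂ (1F , h) = ℕP.m≤n⇒m≤o+n (nonOpposite a b c) (ℕP.m≤n⇒m≤o+n (inD b c a)
                            (ℕP.m≤n⇒m≤n+o _ (1≤𝟙 (InD? n (P C) a c b) h)))
    ... | inj₂ (2F , h) = ℕP.m≤n⇒m≤o+n (nonOpposite a b c) (ℕP.m≤n⇒m≤o+n (inD b c a)
                            (ℕP.m≤n⇒m≤o+n (inD a c b) (1≤𝟙 (InD? n (P C) a b c) h)))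

    distinct-≤-nonOpposite+extraLabels :
      ∑₃ distinct ≤ ∑₃ (λ a b c → distinct a b c * nonOpposite a b c) + 3 * extraLabels
    distinct-≤-nonOpposite+extraLabels = begin
      ∑₃ distinct
        ≡⟨ ∑₃-cong (λ a b c → ℕP.*-identityʳ (distinct a b c)) ⟨
      ∑₃ (λ a b c → distinct a b c * 1)
        ≤⟨ ∑₃-mono-≤ (λ a b c → 𝟙-*-mono (Distinct? (a , b , c)) (1≤nonOpposite+inD a b c)) ⟩
      ∑₃ (λ a b c → distinct a b c * (nonOpposite a b c + (inD b c a + (inD a c b + inD a b c))))
        ≡⟨ ∑₃-cong (λ a b c → distribute (distinct a b c) (nonOpposite a b c)
                                         (inD b c a) (inD a c b) (inD a b c)) ⟩
      ∑₃ (λ a b c → distinct a b c * nonOpposite a b c + (distinct a b c * inD b c a +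
                     (distinct a b c * inD a c b + distinct a b c * inD a b c)))
        ≡⟨ trans (∑₃-distrib-+ _ _)
                 (cong (G +_) (trans (∑₃-distrib-+ _ _) (cong (T₀ +_) (∑₃-distrib-+ _ _)))) ⟩
      G + (T₀ + (T₁ + extraLabels))
        ≡⟨ cong₂ (λ x y → G + (x + (y + extraLabels))) T₀≡ T₁≡ ⟩
      G + (extraLabels + (extraLabels + extraLabels))
        ≡⟨ cong (λ x → G + (extraLabels + (extraLabels + x))) (ℕP.+-identityʳ extraLabels) ⟨
      G + 3 * extraLabels ∎
      where
      open ℕP.≤-Reasoning
      G  = ∑₃ (λ a b c → distinct a b c * nonOpposite a b c)
      T₀ = ∑₃ (λ a b c → distinct a b c * inD b c a)
      T₁ = ∑₃ (λ a b c → distinct a b c * inD a c b)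
      distribute : ∀ d x y z w → d * (x + (y + (z + w))) ≡ d * x + (d * y + (d * z + d * w))
      distribute d x y z w = trans (ℕP.*-distribˡ-+ d x _) (cong (d * x +_)
                               (trans (ℕP.*-distribˡ-+ d y _) (cong (d * y +_) (ℕP.*-distribˡ-+ d z w))))
      T₀≡ : T₀ ≡ extraLabels
      T₀≡ = trans (∑₃-cong (λ a b c → cong (_* inD b c a) (sym (distinct-rotate a b c))))
                  (∑₃-rotate (λ a b c → distinct a b c * inD a b c))
      T₁≡ : T₁ ≡ extraLabels
      T₁≡ = trans (∑₃-cong (λ a b c → cong (_* inD a c b) (sym (distinct-swap₂₃ a b c))))
                  (∑₃-swap₂₃ (λ a b c → distinct a b c * inD a b c))

    extraLabelsOn : Fin k → Fin k → ℕ
    extraLabelsOn a b = ∑[ c < k ] (distinct a b c * inD a b c)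

    distinct*inD+𝟙-≟≤inD : ∀ {a b} → a ≢ b → ∀ c →
                           distinct a b c * inD a b c + (𝟙 (c FinP.≟ a) + 𝟙 (c FinP.≟ b)) ≤ inD a b c
    distinct*inD+𝟙-≟≤inD {a} {b} a≢b c with c FinP.≟ a | c FinP.≟ b
    ... | yes refl | yes refl = contradiction refl a≢b
    ... | yes refl | no _     = ℕP.≤-reflexive (trans (cong (λ d → d * inD a b a + 1) (distinct-≡₁₃ a b))
                                                      (sym (𝟙-yes (InD? n (P C) a b a) (InD-vertex C a b))))
    ... | no _     | yes refl = ℕP.≤-reflexive (trans (cong (λ d → d * inD a b b + 1) (distinct-≡₂₃ a b))
                                                      (sym (𝟙-yes (InD? n (P C) a b b) (InD-swap (InD-vertex C b a)))))
    ... | no _     | no _     = ℕP.≤-trans (ℕP.≤-reflexive (ℕP.+-identityʳ _))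
                                           (𝟙-*-≤ (Distinct? (a , b , c)) (inD a b c))

    extraLabelsOn+2≤cardD : ∀ {a b} → a ≢ b → extraLabelsOn a b + 2 ≤ cardD n (P C) a b
    extraLabelsOn+2≤cardD {a} {b} a≢b = begin
      extraLabelsOn a b + 2
        ≡⟨ ∑-+-𝟙-≟ (λ c → distinct a b c * inD a b c) a b ⟨
      ∑[ c < k ] (distinct a b c * inD a b c + (𝟙 (c FinP.≟ a) + 𝟙 (c FinP.≟ b)))
        ≤⟨ ∑-mono-≤ (distinct*inD+𝟙-≟≤inD a≢b) ⟩
      ∑[ c < k ] inD a b c
        ≡⟨ cardD≡∑inD a b ⟨
      cardD n (P C) a b ∎
      where open ℕP.≤-Reasoning

    extraLabels-bound : extraLabels + 4 * ∑₂ below ≤ 2 * ∑₂ (λ a b → below a b * cardD n (P C) a b)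
    extraLabels-bound = begin
      extraLabels + 4 * B
        ≡⟨ cong₂ _+_ (∑₂-symmetric extraLabelsOn extraLabelsOn-sym extraLabelsOn-diag)
                     (trans (ℕP.*-assoc 2 2 B) (cong (2 *_) (ℕP.*-comm 2 B))) ⟩
      2 * X + 2 * (B * 2)
        ≡⟨ ℕP.*-distribˡ-+ 2 X (B * 2) ⟨
      2 * (X + B * 2)
        ≡⟨ cong (2 *_) (trans (∑₂-distrib-+ _ _) (cong (X +_) (∑₂-*ʳ below 2))) ⟨
      2 * ∑₂ (λ a b → below a b * extraLabelsOn a b + below a b * 2)
        ≡⟨ cong (2 *_) (∑₂-cong (λ a b → ℕP.*-distribˡ-+ (below a b) (extraLabelsOn a b) 2)) ⟨
      2 * ∑₂ (λ a b → below a b * (extraLabelsOn a b + 2))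
        ≤⟨ ℕP.*-monoʳ-≤ 2 (∑₂-mono-≤ λ a b →
             𝟙-*-mono (toℕ a <? toℕ b) (extraLabelsOn+2≤cardD ∘ below-≢)) ⟩
      2 * ∑₂ (λ a b → below a b * cardD n (P C) a b) ∎
      where
      open ℕP.≤-Reasoning
      B = ∑₂ below
      X = ∑₂ (λ a b → below a b * extraLabelsOn a b)
      extraLabelsOn-sym : ∀ a b → extraLabelsOn a b ≡ extraLabelsOn b a
      extraLabelsOn-sym a b = sum-cong-≗ (λ c → cong₂ _*_ (sym (distinct-swap₁₂ a b c))
                                                 (𝟙-cong (InD? n (P C) a b c) (InD? n (P C) b a c) InD-swap InD-swap))
      extraLabelsOn-diag : ∀ a → extraLabelsOn a a ≡ 0
      extraLabelsOn-diag a = trans (sum-cong-≗ (λ c → cong (_* inD a a c) (distinct-≡₁₂ a c)))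
                                   (sum-replicate-zero k)

    nonOpposite-count-bound :
      ∑₃ distinct + 12 * ∑₂ below ≤
      ∑₃ (λ a b c → distinct a b c * nonOpposite a b c) + 6 * ∑₂ (λ a b → below a b * cardD n (P C) a b)
    nonOpposite-count-bound = begin
      ∑₃ distinct + 12 * B                  ≤⟨ ℕP.+-monoˡ-≤ (12 * B) distinct-≤-nonOpposite+extraLabels ⟩
      G + 3 * extraLabels + 12 * B          ≡⟨ solve 3 (λ g e b → g :+ con 3 :* e :+ con 12 :* b
                                                               := g :+ con 3 :* (e :+ con 4 :* b)) refl G extraLabels B ⟩
      G + 3 * (extraLabels + 4 * B)         ≤⟨ ℕP.+-monoʳ-≤ G (ℕP.*-monoʳ-≤ 3 extraLabels-bound) ⟩
      G + 3 * (2 * S)                       ≡⟨ cong (G +_) (ℕP.*-assoc 3 2 S) ⟨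
      G + 6 * S                             ∎
      where
      open ℕP.≤-Reasoning
      open +-*-Solver
      B = ∑₂ below
      G = ∑₃ (λ a b c → distinct a b c * nonOpposite a b c)
      S = ∑₂ (λ a b → below a b * cardD n (P C) a b)


module Fractions where

  open import Data.Nat as ℕ using (ℕ; suc; _+_; _*_) renaming (_≤_ to _≤ℕ_)
  import Data.Nat.Properties as ℕP
  open import Data.Integer as ℤ using (+_)
  import Data.Integer.Properties as ℤP
  open import Data.Rational as ℚ using (ℚ; _/_; 1ℚ; toℚᵘ) renaming (_≤_ to _≤ℚ_)
  import Data.Rational.Properties as ℚP
  open import Data.Rational.Unnormalised as ℚᵘ using (ℚᵘ; mkℚᵘ; *≡*; *≤*)
  import Data.Rational.Unnormalised.Properties as ℚᵘP
  open import Data.Rational.Solver using (module +-*-Solver)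
  open import Relation.Binary.PropositionalEquality

  ι : ℕ → ℚ
  ι a = + a / 1

  private
    toℚᵘ-ι : ∀ a → toℚᵘ (ι a) ℚᵘ.≃ mkℚᵘ (+ a) 0
    toℚᵘ-ι a = ℚP.toℚᵘ-fromℚᵘ (mkℚᵘ (+ a) 0)

  ι-+ : ∀ a b → ι (a + b) ≡ ι a ℚ.+ ι b
  ι-+ a b = ℚP.toℚᵘ-injective (begin
    toℚᵘ (ι (a + b))                  ≈⟨ toℚᵘ-ι (a + b) ⟩
    mkℚᵘ (+ (a + b)) 0                 ≈⟨ *≡* (cong (ℤ._* + 1) (trans (ℤP.pos-+ a b)
                                             (sym (cong₂ ℤ._+_ (ℤP.*-identityʳ (+ a)) (ℤP.*-identityʳ (+ b)))))) ⟩
    mkℚᵘ (+ a) 0 ℚᵘ.+ mkℚᵘ (+ b) 0     ≈⟨ ℚᵘP.+-cong (toℚᵘ-ι a) (toℚᵘ-ι b) ⟨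
    toℚᵘ (ι a) ℚᵘ.+ toℚᵘ (ι b)         ≈⟨ ℚP.toℚᵘ-homo-+ (ι a) (ι b) ⟨
    toℚᵘ (ι a ℚ.+ ι b)                 ∎)
    where open ℚᵘP.≃-Reasoning

  ι-* : ∀ a b → ι (a * b) ≡ ι a ℚ.* ι b
  ι-* a b = ℚP.toℚᵘ-injective (begin
    toℚᵘ (ι (a * b))                  ≈⟨ toℚᵘ-ι (a * b) ⟩
    mkℚᵘ (+ (a * b)) 0                 ≈⟨ *≡* (cong (ℤ._* + 1) (ℤP.pos-* a b)) ⟩
    mkℚᵘ (+ a) 0 ℚᵘ.* mkℚᵘ (+ b) 0     ≈⟨ ℚᵘP.*-cong (toℚᵘ-ι a) (toℚᵘ-ι b) ⟨
    toℚᵘ (ι a) ℚᵘ.* toℚᵘ (ι b)         ≈⟨ ℚP.toℚᵘ-homo-* (ι a) (ι b) ⟨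
    toℚᵘ (ι a ℚ.* ι b)                 ∎)
    where open ℚᵘP.≃-Reasoning

  ι-mono-≤ : ∀ {a b} → a ≤ℕ b → ι a ≤ℚ ι b
  ι-mono-≤ {a} {b} a≤b = ℚP.toℚᵘ-cancel-≤
    (ℚᵘP.≤-respˡ-≃ (ℚᵘP.≃-sym (toℚᵘ-ι a)) (ℚᵘP.≤-respʳ-≃ (ℚᵘP.≃-sym (toℚᵘ-ι b))
      (*≤* (ℤP.*-monoʳ-≤-nonNeg (+ 1) (ℤ.+≤+ a≤b)))))

  /ℕ-*-ι : ∀ a b → (a /ℕ suc b) ℚ.* ι (suc b) ≡ ι a
  /ℕ-*-ι a b = ℚP.toℚᵘ-injective (begin
    toℚᵘ ((+ a / suc b) ℚ.* ι (suc b))           ≈⟨ ℚP.toℚᵘ-homo-* (+ a / suc b) (ι (suc b)) ⟩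
    toℚᵘ (+ a / suc b) ℚᵘ.* toℚᵘ (ι (suc b))      ≈⟨ ℚᵘP.*-cong (ℚP.toℚᵘ-fromℚᵘ (mkℚᵘ (+ a) b)) (toℚᵘ-ι (suc b)) ⟩
    mkℚᵘ (+ a) b ℚᵘ.* mkℚᵘ (+ suc b) 0            ≈⟨ *≡* (trans (ℤP.*-identityʳ _)
                                                      (cong (λ z → + a ℤ.* + suc z) (sym (ℕP.*-identityʳ b)))) ⟩
    mkℚᵘ (+ a) 0                                  ≈⟨ toℚᵘ-ι a ⟨
    toℚᵘ (ι a)                                    ∎)
    where open ℚᵘP.≃-Reasoning

  fraction-bound : ∀ S P G N j → 1 ≤ℕ P → N ≡ 2 * P * suc j → N + 12 * P ≤ℕ G + 6 * S →
    1ℚ ℚ.- ((ι 3 ℚ.* (S /ℕ P ℚ.- ι 2)) ÷ℕ suc j) ≤ℚ G /ℕ N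
  fraction-bound S P@(suc p) G _ j _ refl ineq =
    ℚP.*-cancelʳ-≤-pos (ι N) {{ℚP.normalize-pos N 1}} (begin
      L ℚ.* ι N                                        ≡⟨ expand ⟩
      (ι N ℚ.+ ι 12 ℚ.* ι P) ℚ.- ι 6 ℚ.* ι S            ≤⟨ ℚP.+-monoˡ-≤ (ℚ.- (ι 6 ℚ.* ι S)) ineqℚ ⟩
      (ι G ℚ.+ ι 6 ℚ.* ι S) ℚ.- ι 6 ℚ.* ι S             ≡⟨ solve 2 (λ g s → (g :+ s) :- s := g) refl (ι G) (ι 6 ℚ.* ι S) ⟩
      ι G                                              ≡⟨ /ℕ-*-ι G _ ⟨
      (G /ℕ N) ℚ.* ι N                                 ∎)
    where
    open ℚP.≤-Reasoning
    open +-*-Solver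
    K = suc j
    N = 2 * P * K
    d = S /ℕ P
    b = + 1 / K
    L = 1ℚ ℚ.- (ι 3 ℚ.* (d ℚ.- ι 2)) ℚ.* b
    ineqℚ : ι N ℚ.+ ι 12 ℚ.* ι P ≤ℚ ι G ℚ.+ ι 6 ℚ.* ι S
    ineqℚ = subst₂ _≤ℚ_ (trans (ι-+ N (12 * P)) (cong (ι N ℚ.+_) (ι-* 12 P)))
                        (trans (ι-+ G (6 * S)) (cong (ι G ℚ.+_) (ι-* 6 S)))
                        (ι-mono-≤ ineq)
    ιN : ι N ≡ ι 2 ℚ.* ι P ℚ.* ι K
    ιN = trans (ι-* (2 * P) K) (cong (ℚ._* ι K) (ι-* 2 P))
    expand : L ℚ.* ι N ≡ (ι N ℚ.+ ι 12 ℚ.* ι P) ℚ.- ι 6 ℚ.* ι S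
    expand = begin-equality
      L ℚ.* ι N
        ≡⟨ cong (L ℚ.*_) ιN ⟩
      L ℚ.* (ι 2 ℚ.* ι P ℚ.* ι K)
        ≡⟨ solve 4 (λ d b p k →
             (con 1ℚ :- (con (ι 3) :* (d :- con (ι 2))) :* b) :* (con (ι 2) :* p :* k) :=
             (con (ι 2) :* p :* k :+ con (ι 12) :* p :* (b :* k)) :- con (ι 6) :* (d :* p) :* (b :* k))
             refl d b (ι P) (ι K) ⟩
      (ι 2 ℚ.* ι P ℚ.* ι K ℚ.+ ι 12 ℚ.* ι P ℚ.* (b ℚ.* ι K)) ℚ.- ι 6 ℚ.* (d ℚ.* ι P) ℚ.* (b ℚ.* ι K)
        ≡⟨ cong₂ (λ s u → (ι 2 ℚ.* ι P ℚ.* ι K ℚ.+ ι 12 ℚ.* ι P ℚ.* u) ℚ.- ι 6 ℚ.* s ℚ.* u)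
                 (/ℕ-*-ι S p) (/ℕ-*-ι 1 j) ⟩
      (ι 2 ℚ.* ι P ℚ.* ι K ℚ.+ ι 12 ℚ.* ι P ℚ.* 1ℚ) ℚ.- ι 6 ℚ.* ι S ℚ.* 1ℚ
        ≡⟨ cong (λ x → (x ℚ.+ ι 12 ℚ.* ι P ℚ.* 1ℚ) ℚ.- ι 6 ℚ.* ι S ℚ.* 1ℚ) ιN ⟨
      (ι N ℚ.+ ι 12 ℚ.* ι P ℚ.* 1ℚ) ℚ.- ι 6 ℚ.* ι S ℚ.* 1ℚ
        ≡⟨ cong₂ (λ x y → (ι N ℚ.+ x) ℚ.- y) (ℚP.*-identityʳ _) (ℚP.*-identityʳ _) ⟩
      (ι N ℚ.+ ι 12 ℚ.* ι P) ℚ.- ι 6 ℚ.* ι S ∎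

open Counting
open Fractions using (fraction-bound)
open import Data.Nat using (ℕ; _∸_) renaming (_≤_ to _≤ℕ_)
open import Data.Integer using (+_)
open import Data.Rational using (_/_; _≤_; _-_; _*_; 1ℚ)
import Data.Nat as ℕ
open import Data.Nat.ListAction using (sum)
open import Data.List using (map; filter; length)
open import Data.Fin using (Fin)
open import Data.Product using (_×_; proj₁; proj₂)
open import Relation.Binary.PropositionalEquality using (_≡_; refl; sym; trans; cong; cong₂; subst₂)

proposition9 : (k n : ℕ) → 3 ≤ℕ k → 1 ≤ℕ n → (C : Cut k n) →
    1ℚ - ((((+ 3) / 1) * (D C - ((+ 2) / 1))) ÷ℕ (k ∸ 2)) ≤ probNonOpposite C
proposition9 k@(ℕ.suc (ℕ.suc (ℕ.suc m))) n (ℕ.s≤s (ℕ.s≤s (ℕ.s≤s ℕ.z≤n))) _ C =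
  fraction-bound sumD nPairs nGood nTriples m nPairs-pos nTriples≡ counts
  where
  open Indices k
  cardDₚ = λ (p : Fin k × Fin k) → cardD n (P C) (proj₁ p) (proj₂ p)
  nonOpposite? = λ (t : Triple k) → IsNonOppositeCut? n (restrict (P C) t)
  sumD     = sum (map cardDₚ (pairs k))
  nPairs   = length (pairs k)
  nGood    = length (filter nonOpposite? (distinctTriples k))
  nTriples = length (distinctTriples k)
  -- by evaluation: (0, 1) is the second pair of the enumeration
  nPairs-pos : 1 ≤ℕ nPairs
  nPairs-pos = ℕ.s≤s ℕ.z≤n
  nTriples≡ : nTriples ≡ 2 ℕ.* nPairs ℕ.* ℕ.suc m
  nTriples≡ = trans length-distinctTriples
    (trans (∑₃-distinct (ℕ.suc m) refl) (cong (λ x → 2 ℕ.* x ℕ.* ℕ.suc m) (sym length-pairs)))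
  counts : nTriples ℕ.+ 12 ℕ.* nPairs ≤ℕ nGood ℕ.+ 6 ℕ.* sumD
  counts = subst₂ _≤ℕ_
    (sym (cong₂ (λ x y → x ℕ.+ 12 ℕ.* y) length-distinctTriples length-pairs))
    (sym (cong₂ (λ x y → x ℕ.+ 6 ℕ.* y) (length-filter-distinctTriples nonOpposite?) (sum-map-pairs cardDₚ)))
    (nonOpposite-count-bound C)
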